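{- Free product is associative: for matroids $M$ on $S$, $N$ on $T$ and $P$ on $U$ with $S,T,U$ pairwise disjoint, $(M\mathbin{\Box} N)\mathbin{\Box} P=M\mathbin{\Box}(N\mathbin{\Box} P)$.
   Context: For a matroid $M$ on $S$, $\rho(M)$ is its rank, $\nu_M(A)=|A|-\rho_M(A)$ the nullity and $\lambda_M(A)=\rho(M)-\rho_M(A)$ the rank-lack. For matroids $M$ on $S$ and $N$ on $T$ with $S\cap T=\emptyset$, the free product $M\mathbin{\Box} N$ is the matroid on $S\cup T$ whose independent sets are the $A\subseteq S\cup T$ such that $A\cap S$ is independent in $M$ and $\lambda_M(A\cap S)\geq\nu_N(A\cap T)$. -}

module Defs where

open import Level using (0ℓ)
open import Data.Nat using (ℕ; zero; suc; _+_; _∸_; _≤_; _<_; _⊔_)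
open import Data.Nat.Properties using (_≤?_)
open import Data.Bool using (Bool; true; false)
open import Data.Product using (_×_; _,_; ∃-syntax)
open import Data.List using (List; []; _∷_; map; _++_)
open import Data.Vec using (Vec; []; _∷_; take; drop)
open import Data.Fin.Subset using (Subset; ⊤; ⊥; ∣_∣; _⊆_; _∪_; ⁅_⁆; _∈_; _∉_)
open import Data.Fin.Subset.Properties using (_⊆?_)
open import Relation.Nullary using (Dec; yes; no; ¬_)
open import Relation.Nullary.Decidable using (_×-dec_)
open import Relation.Unary using (Decidable)

record SetSystem (n : ℕ) : Set₁ where
  field
    Indep  : Subset n → Set
    Indep? : Decidable Indep

record Matroid (n : ℕ) : Set₁ where
  field
    system    : SetSystem n
    indep-⊥   : SetSystem.Indep system ⊥
    indep-⊆   : ∀ {I J} → I ⊆ J → SetSystem.Indep system J → SetSystem.Indep system I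
    augment   : ∀ {I J} → SetSystem.Indep system I → SetSystem.Indep system J →
                ∣ I ∣ < ∣ J ∣ →
                ∃[ x ] (x ∈ J × x ∉ I × SetSystem.Indep system (I ∪ ⁅ x ⁆))

open SetSystem public
open Matroid public

allSubsets : (n : ℕ) → List (Subset n)
allSubsets zero    = [] ∷ []
allSubsets (suc n) = map (false ∷_) (allSubsets n) ++ map (true ∷_) (allSubsets n)

rankOf : ∀ {n} → SetSystem n → Subset n → ℕ
rankOf {n} E A = go (allSubsets n)
  where
  go : List (Subset n) → ℕ
  go []       = 0
  go (I ∷ Is) with I ⊆? A ×-dec Indep? E I
  ... | yes _ = ∣ I ∣ ⊔ go Is
  ... | no  _ = go Is

ρ : ∀ {n} → SetSystem n → ℕ
ρ E = rankOf E ⊤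

nullity : ∀ {n} → SetSystem n → Subset n → ℕ
nullity E A = ∣ A ∣ ∸ rankOf E A

rankLack : ∀ {n} → SetSystem n → Subset n → ℕ
rankLack E A = ρ E ∸ rankOf E A

-- Free product on the disjoint union Fin (s + t): the first s points form S,
-- the last t points form T.  A ∩ S = take s A, A ∩ T = drop s A.
_□_ : ∀ {s t} → SetSystem s → SetSystem t → SetSystem (s + t)
_□_ {s} {t} M N = record
  { Indep  = λ A → Indep M (take s A) × nullity N (drop s A) ≤ rankLack M (take s A)
  ; Indep? = λ A → Indep? M (take s A) ×-dec (nullity N (drop s A) ≤? rankLack M (take s A))
  }

{-# OPTIONS --safe #-}
-- The free product has rank function
--   r(X ⊎ Y) = r_M(X) + r_N(Y) + min(ν_N(Y), λ_M(X)),
-- attained by a basis of X together with a basis of Y padded by min(ν_N(Y), λ_M(X))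
-- further elements of Y.  Consequently
--   ν(X ⊎ Y) = ν_M(X) + (ν_N(Y) ∸ λ_M(X))   and   λ(X ⊎ Y) = λ_N(Y) + (λ_M(X) ∸ ν_N(Y)).
-- With a = λ_M(X), b = ν_N(Y), c = λ_N(Y), d = ν_P(Z), independence of X ⊎ Y ⊎ Z then
-- means X ∈ I(M) together with b ≤ a and d ≤ c + (a ∸ b) in (M □ N) □ P, and together
-- with b + (d ∸ c) ≤ a in M □ (N □ P); these two conditions on naturals are equivalent.
module Submission where

open import Defs
open import Data.Nat using (ℕ; zero; suc; _+_; _∸_; _≤_; _⊓_; z≤n; s≤s⁻¹)
open import Data.Nat.Properties
open import Data.Nat.Tactic.RingSolver using (solve-∀)
open import Algebra.Properties.CommutativeSemigroup +-commutativeSemigroup using (x∙yz≈y∙xz)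
open import Data.Product using (_×_; _,_; ∃-syntax; proj₁; proj₂)
open import Data.Sum using (inj₁; inj₂)
open import Data.Empty using (⊥-elim)
open import Data.List using (List; []; _∷_; map)
import Data.List.Relation.Unary.Any as Any
open import Data.List.Membership.Propositional using () renaming (_∈_ to _∈ˡ_)
open import Data.List.Membership.Propositional.Properties using (∈-++⁺ˡ; ∈-++⁺ʳ; ∈-map⁺)
open import Data.Vec using (Vec; []; _∷_; _++_; take; drop; cast; here)
open import Data.Vec.Properties using (take++drop≡id; ++-injective; ++-assoc-eqFree)
open import Data.Fin.Subset using (Subset; ⊤; ⊥; ∣_∣; _⊆_; inside; outside)
open import Data.Fin.Subset.Properties
  using (_⊆?_; ⊆-refl; ⊆-trans; ⊆-min; ⊆⊤; drop-∷-⊆; out⊆; in⊆in; p⊆q⇒∣p∣≤∣q∣; ∣⊥∣≡0)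
open import Function.Bundles using (_⇔_; mk⇔; Equivalence)
open import Relation.Nullary using (yes; no)
open import Relation.Nullary.Decidable using (_×-dec_)
open import Relation.Binary.PropositionalEquality
  using (_≡_; refl; sym; trans; cong; cong₂; subst; subst₂; module ≡-Reasoning)

-- The list fold computing rankOf is local to its where block; maxIndepSize is
-- that fold, named here by letting unification solve for it.
private
  mutual
    maxIndepSize : ∀ {n} → SetSystem n → Subset n → List (Subset n) → ℕ
    maxIndepSize = _

    rankOf≡maxIndepSize : ∀ {n} (E : SetSystem n) A → rankOf E A ≡ maxIndepSize E A (allSubsets n)
    rankOf≡maxIndepSize {n} E A with allSubsets n
    ... | _ = refl

∈-allSubsets : ∀ {n} (p : Subset n) → p ∈ˡ allSubsets n
∈-allSubsets []                     = Any.here refl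
∈-allSubsets {suc n} (outside ∷ p) = ∈-++⁺ˡ (∈-map⁺ (outside ∷_) (∈-allSubsets p))
∈-allSubsets {suc n} (inside ∷ p)  =
  ∈-++⁺ʳ (map (outside ∷_) (allSubsets n)) (∈-map⁺ (inside ∷_) (∈-allSubsets p))

module _ {n} (E : SetSystem n) {A : Subset n} where

  maxIndepSize-≥ : ∀ {I} L → I ∈ˡ L → I ⊆ A → Indep E I → ∣ I ∣ ≤ maxIndepSize E A L
  maxIndepSize-≥ (J ∷ Js) I∈ I⊆A indep with J ⊆? A ×-dec Indep? E J
  maxIndepSize-≥ (J ∷ Js) (Any.here refl) I⊆A indep | yes _ = m≤m⊔n _ _
  maxIndepSize-≥ (J ∷ Js) (Any.there I∈) I⊆A indep | yes _ =
    ≤-trans (maxIndepSize-≥ Js I∈ I⊆A indep) (m≤n⊔m _ _)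
  maxIndepSize-≥ (J ∷ Js) (Any.here refl) I⊆A indep | no ¬J = ⊥-elim (¬J (I⊆A , indep))
  maxIndepSize-≥ (J ∷ Js) (Any.there I∈) I⊆A indep | no _ = maxIndepSize-≥ Js I∈ I⊆A indep

  maxIndepSize-lub : ∀ {k} → (∀ {I} → I ⊆ A → Indep E I → ∣ I ∣ ≤ k) →
                     ∀ L → maxIndepSize E A L ≤ k
  maxIndepSize-lub bound []       = z≤n
  maxIndepSize-lub bound (J ∷ Js) with J ⊆? A ×-dec Indep? E J
  ... | yes (J⊆A , indep) = ⊔-lub (bound J⊆A indep) (maxIndepSize-lub bound Js)
  ... | no _              = maxIndepSize-lub bound Js

  maxIndepSize-attained : Indep E ⊥ → ∀ L →
                          ∃[ I ] (I ⊆ A × Indep E I × ∣ I ∣ ≡ maxIndepSize E A L)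
  maxIndepSize-attained ∅-indep []       = ⊥ , ⊆-min A , ∅-indep , ∣⊥∣≡0 n
  maxIndepSize-attained ∅-indep (J ∷ Js) with J ⊆? A ×-dec Indep? E J
  ... | no _ = maxIndepSize-attained ∅-indep Js
  ... | yes (J⊆A , indep) with ≤-total (maxIndepSize E A Js) ∣ J ∣
  ...   | inj₁ rest≤∣J∣ = J , J⊆A , indep , sym (m≥n⇒m⊔n≡m rest≤∣J∣)
  ...   | inj₂ ∣J∣≤rest with maxIndepSize-attained ∅-indep Js
  ...     | I , I⊆A , indepI , ∣I∣≡rest =
    I , I⊆A , indepI , trans ∣I∣≡rest (sym (m≤n⇒m⊔n≡n ∣J∣≤rest))

module _ {n} (E : SetSystem n) where

  ∣I∣≤rankOf : ∀ {I A} → I ⊆ A → Indep E I → ∣ I ∣ ≤ rankOf E A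
  ∣I∣≤rankOf {I} {A} I⊆A indep rewrite rankOf≡maxIndepSize E A =
    maxIndepSize-≥ E (allSubsets n) (∈-allSubsets I) I⊆A indep

  rankOf-lub : ∀ {A k} → (∀ {I} → I ⊆ A → Indep E I → ∣ I ∣ ≤ k) → rankOf E A ≤ k
  rankOf-lub {A} bound rewrite rankOf≡maxIndepSize E A = maxIndepSize-lub E bound (allSubsets n)

  basis : Indep E ⊥ → ∀ A → ∃[ I ] (I ⊆ A × Indep E I × ∣ I ∣ ≡ rankOf E A)
  basis ∅-indep A rewrite rankOf≡maxIndepSize E A = maxIndepSize-attained E ∅-indep (allSubsets n)

  rankOf≤∣_∣ : ∀ A → rankOf E A ≤ ∣ A ∣
  rankOf≤∣ A ∣ = rankOf-lub (λ I⊆A _ → p⊆q⇒∣p∣≤∣q∣ I⊆A)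

  rankOf-mono : ∀ {A B} → A ⊆ B → rankOf E A ≤ rankOf E B
  rankOf-mono A⊆B = rankOf-lub (λ I⊆A → ∣I∣≤rankOf (⊆-trans I⊆A A⊆B))

  rankOf-indep : ∀ {I} → Indep E I → rankOf E I ≡ ∣ I ∣
  rankOf-indep {I} indep = ≤-antisym rankOf≤∣ I ∣ (∣I∣≤rankOf ⊆-refl indep)

  rankOf+nullity : ∀ A → rankOf E A + nullity E A ≡ ∣ A ∣
  rankOf+nullity A = m+[n∸m]≡n rankOf≤∣ A ∣

  rankOf+rankLack : ∀ A → rankOf E A + rankLack E A ≡ ρ E
  rankOf+rankLack A = m+[n∸m]≡n (rankOf-mono ⊆⊤)

module _ {a} {A : Set a} {m n} (xs : Vec A m) (ys : Vec A n) where

  take-++ : take m (xs ++ ys) ≡ xs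
  take-++ = proj₁ (++-injective (take m (xs ++ ys)) xs (take++drop≡id m (xs ++ ys)))

  drop-++ : drop m (xs ++ ys) ≡ ys
  drop-++ = proj₂ (++-injective (take m (xs ++ ys)) xs (take++drop≡id m (xs ++ ys)))

∣p++q∣≡∣p∣+∣q∣ : ∀ {s t} (p : Subset s) (q : Subset t) → ∣ p ++ q ∣ ≡ ∣ p ∣ + ∣ q ∣
∣p++q∣≡∣p∣+∣q∣ []            q = refl
∣p++q∣≡∣p∣+∣q∣ (outside ∷ p) q = ∣p++q∣≡∣p∣+∣q∣ p q
∣p++q∣≡∣p∣+∣q∣ (inside ∷ p)  q = cong suc (∣p++q∣≡∣p∣+∣q∣ p q)

⊤++⊤≡⊤ : ∀ {s t} → ⊤ {s} ++ ⊤ {t} ≡ ⊤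
⊤++⊤≡⊤ {zero}  = refl
⊤++⊤≡⊤ {suc s} = cong (inside ∷_) (⊤++⊤≡⊤ {s})

module _ {t : ℕ} where

  ++-⊆ : ∀ {s} {p q : Subset s} {p′ q′ : Subset t} → p ⊆ q → p′ ⊆ q′ → p ++ p′ ⊆ q ++ q′
  ++-⊆ {p = []}          {[]}    _   p′⊆q′ = p′⊆q′
  ++-⊆ {p = outside ∷ p} {_ ∷ q} p⊆q p′⊆q′ = out⊆ (++-⊆ (drop-∷-⊆ p⊆q) p′⊆q′)
  ++-⊆ {p = inside ∷ p}  {_ ∷ q} p⊆q p′⊆q′ with p⊆q here
  ... | here = in⊆in (++-⊆ (drop-∷-⊆ p⊆q) p′⊆q′)

  ++-⊆⁻ : ∀ {s} {p q : Subset s} {p′ q′ : Subset t} → p ++ p′ ⊆ q ++ q′ → p ⊆ q × p′ ⊆ q′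
  ++-⊆⁻ {p = []}          {[]}    p⊆q = ⊆-refl , p⊆q
  ++-⊆⁻ {p = outside ∷ p} {_ ∷ q} p⊆q with ++-⊆⁻ {p = p} {q} (drop-∷-⊆ p⊆q)
  ... | p⊆q′ , rest = out⊆ p⊆q′ , rest
  ++-⊆⁻ {p = inside ∷ p}  {_ ∷ q} p⊆q with p⊆q here | ++-⊆⁻ {p = p} {q} (drop-∷-⊆ p⊆q)
  ... | here | p⊆q′ , rest = in⊆in p⊆q′ , rest

⊆-between : ∀ {n} {p q : Subset n} → p ⊆ q → ∀ k → ∣ p ∣ + k ≤ ∣ q ∣ →
            ∃[ r ] (p ⊆ r × r ⊆ q × ∣ r ∣ ≡ ∣ p ∣ + k)
⊆-between {p = []} {[]} _ zero _ = [] , ⊆-refl , ⊆-refl , refl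
⊆-between {p = inside ∷ p} {_ ∷ q} p⊆q k fits with p⊆q here
... | here with ⊆-between (drop-∷-⊆ p⊆q) k (s≤s⁻¹ fits)
...   | r , p⊆r , r⊆q , ∣r∣≡ = inside ∷ r , in⊆in p⊆r , in⊆in r⊆q , cong suc ∣r∣≡
⊆-between {p = outside ∷ p} {outside ∷ q} p⊆q k fits with ⊆-between (drop-∷-⊆ p⊆q) k fits
... | r , p⊆r , r⊆q , ∣r∣≡ = outside ∷ r , out⊆ p⊆r , out⊆ r⊆q , ∣r∣≡
⊆-between {p = outside ∷ p} {inside ∷ q} p⊆q zero _ =
  outside ∷ p , ⊆-refl , p⊆q , sym (+-identityʳ ∣ p ∣)
⊆-between {p = outside ∷ p} {inside ∷ q} p⊆q (suc k) fits
  with ⊆-between (drop-∷-⊆ p⊆q) k (s≤s⁻¹ (subst (_≤ suc ∣ q ∣) (+-suc ∣ p ∣ k) fits))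
... | r , p⊆r , r⊆q , ∣r∣≡ =
  inside ∷ r , out⊆ p⊆r , in⊆in r⊆q , trans (cong suc ∣r∣≡) (sym (+-suc ∣ p ∣ k))

Indep-□-++ : ∀ {s t} (M : SetSystem s) (N : SetSystem t) X Y →
             Indep (M □ N) (X ++ Y) ≡ (Indep M X × nullity N Y ≤ rankLack M X)
Indep-□-++ M N X Y rewrite take-++ X Y | drop-++ X Y = refl

module _ {s t} {M : SetSystem s} {N : SetSystem t} where

  indep-□-size-bound : ∀ {X Y J₁ J₂} → J₁ ⊆ X → J₂ ⊆ Y →
                       Indep M J₁ → nullity N J₂ ≤ rankLack M J₁ →
                       ∣ J₁ ∣ + ∣ J₂ ∣ ≤ rankOf M X + rankOf N Y + nullity N Y ⊓ rankLack M X
  indep-□-size-bound {X} {Y} {J₁} {J₂} J₁⊆X J₂⊆Y indep₁ ν₂≤λ₁ =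
    subst (∣ J₁ ∣ + ∣ J₂ ∣ ≤_) (sym (+-distribˡ-⊓ (x + z) b a)) (⊓-glb within-Y within-ρM)
    where
    open ≤-Reasoning
    x z a b : ℕ
    x = rankOf M X
    z = rankOf N Y
    a = rankLack M X
    b = nullity N Y

    within-Y : ∣ J₁ ∣ + ∣ J₂ ∣ ≤ x + z + b
    within-Y = begin
      ∣ J₁ ∣ + ∣ J₂ ∣  ≤⟨ +-mono-≤ (∣I∣≤rankOf M J₁⊆X indep₁) (p⊆q⇒∣p∣≤∣q∣ J₂⊆Y) ⟩
      x + ∣ Y ∣        ≡⟨ cong (x +_) (sym (rankOf+nullity N Y)) ⟩
      x + (z + b)      ≡⟨ sym (+-assoc x z b) ⟩
      x + z + b        ∎

    within-ρM : ∣ J₁ ∣ + ∣ J₂ ∣ ≤ x + z + a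
    within-ρM = begin
      ∣ J₁ ∣ + ∣ J₂ ∣
        ≡⟨ cong₂ _+_ (sym (rankOf-indep M indep₁)) (sym (rankOf+nullity N J₂)) ⟩
      rankOf M J₁ + (rankOf N J₂ + nullity N J₂)
        ≤⟨ +-monoʳ-≤ (rankOf M J₁) (+-mono-≤ (rankOf-mono N J₂⊆Y) ν₂≤λ₁) ⟩
      rankOf M J₁ + (z + rankLack M J₁)
        ≡⟨ x∙yz≈y∙xz (rankOf M J₁) z (rankLack M J₁) ⟩
      z + (rankOf M J₁ + rankLack M J₁)
        ≡⟨ cong (z +_) (trans (rankOf+rankLack M J₁) (sym (rankOf+rankLack M X))) ⟩
      z + (x + a)
        ≡⟨ x∙yz≈y∙xz z x a ⟩
      x + (z + a)
        ≡⟨ sym (+-assoc x z a) ⟩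
      x + z + a ∎

  rankOf-□-≤ : ∀ X Y →
               rankOf (M □ N) (X ++ Y) ≤ rankOf M X + rankOf N Y + nullity N Y ⊓ rankLack M X
  rankOf-□-≤ X Y = rankOf-lub (M □ N) bound
    where
    bound : ∀ {J} → J ⊆ X ++ Y → Indep (M □ N) J →
            ∣ J ∣ ≤ rankOf M X + rankOf N Y + nullity N Y ⊓ rankLack M X
    bound {J} J⊆X++Y (indep₁ , ν₂≤λ₁) =
      subst (_≤ _) (trans (sym (∣p++q∣≡∣p∣+∣q∣ J₁ J₂)) (cong ∣_∣ J₁++J₂≡J))
        (indep-□-size-bound (proj₁ J₁⊆X×J₂⊆Y) (proj₂ J₁⊆X×J₂⊆Y) indep₁ ν₂≤λ₁)
      where
      J₁ : Subset s
      J₁ = take s J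
      J₂ : Subset t
      J₂ = drop s J
      J₁++J₂≡J : J₁ ++ J₂ ≡ J
      J₁++J₂≡J = take++drop≡id s J
      J₁⊆X×J₂⊆Y : J₁ ⊆ X × J₂ ⊆ Y
      J₁⊆X×J₂⊆Y = ++-⊆⁻ (subst (_⊆ X ++ Y) (sym J₁++J₂≡J) J⊆X++Y)

  module _ (M-∅ : Indep M ⊥) (N-∅ : Indep N ⊥) where

    rankOf-□-≥ : ∀ X Y →
                 rankOf M X + rankOf N Y + nullity N Y ⊓ rankLack M X ≤ rankOf (M □ N) (X ++ Y)
    rankOf-□-≥ X Y with basis M M-∅ X | basis N N-∅ Y
    ... | B₁ , B₁⊆X , indep₁ , ∣B₁∣≡x | B₂ , B₂⊆Y , indep₂ , ∣B₂∣≡z =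
      pad (⊆-between B₂⊆Y k (subst (λ w → w + k ≤ ∣ Y ∣) (sym ∣B₂∣≡z) z+k≤∣Y∣))
      where
      x z k : ℕ
      x = rankOf M X
      z = rankOf N Y
      k = nullity N Y ⊓ rankLack M X

      z+k≤∣Y∣ : z + k ≤ ∣ Y ∣
      z+k≤∣Y∣ = ≤-trans (+-monoʳ-≤ z (m⊓n≤m _ _)) (≤-reflexive (rankOf+nullity N Y))

      rankLack-B₁ : rankLack M B₁ ≡ rankLack M X
      rankLack-B₁ = cong (ρ M ∸_) (trans (rankOf-indep M indep₁) ∣B₁∣≡x)

      pad : ∃[ Y′ ] (B₂ ⊆ Y′ × Y′ ⊆ Y × ∣ Y′ ∣ ≡ ∣ B₂ ∣ + k) → x + z + k ≤ rankOf (M □ N) (X ++ Y)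
      pad (Y′ , B₂⊆Y′ , Y′⊆Y , ∣Y′∣≡∣B₂∣+k) = begin
        x + z + k          ≡⟨ +-assoc x z k ⟩
        x + (z + k)        ≡⟨ cong₂ _+_ (sym ∣B₁∣≡x) (sym ∣Y′∣≡z+k) ⟩
        ∣ B₁ ∣ + ∣ Y′ ∣    ≡⟨ sym (∣p++q∣≡∣p∣+∣q∣ B₁ Y′) ⟩
        ∣ B₁ ++ Y′ ∣       ≤⟨ ∣I∣≤rankOf (M □ N) (++-⊆ B₁⊆X Y′⊆Y) indep ⟩
        rankOf (M □ N) (X ++ Y) ∎
        where
        open ≤-Reasoning

        ∣Y′∣≡z+k : ∣ Y′ ∣ ≡ z + k
        ∣Y′∣≡z+k = trans ∣Y′∣≡∣B₂∣+k (cong (_+ k) ∣B₂∣≡z)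

        rankOf-Y′ : rankOf N Y′ ≡ z
        rankOf-Y′ = ≤-antisym (rankOf-mono N Y′⊆Y)
                              (subst (_≤ rankOf N Y′) ∣B₂∣≡z (∣I∣≤rankOf N B₂⊆Y′ indep₂))

        nullity-Y′ : nullity N Y′ ≡ k
        nullity-Y′ = trans (cong₂ _∸_ ∣Y′∣≡z+k rankOf-Y′) (m+n∸m≡n z k)

        indep : Indep (M □ N) (B₁ ++ Y′)
        indep = subst (λ P → P) (sym (Indep-□-++ M N B₁ Y′))
                  (indep₁ , subst₂ _≤_ (sym nullity-Y′) (sym rankLack-B₁) (m⊓n≤n _ _))

    rankOf-□ : ∀ X Y →
               rankOf (M □ N) (X ++ Y) ≡ rankOf M X + rankOf N Y + nullity N Y ⊓ rankLack M X
    rankOf-□ X Y = ≤-antisym (rankOf-□-≤ X Y) (rankOf-□-≥ X Y)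

    ρ-□ : ρ (M □ N) ≡ ρ M + ρ N
    ρ-□ = begin
      rankOf (M □ N) ⊤
        ≡⟨ cong (rankOf (M □ N)) (sym (⊤++⊤≡⊤ {s} {t})) ⟩
      rankOf (M □ N) (⊤ {s} ++ ⊤)
        ≡⟨ rankOf-□ ⊤ ⊤ ⟩
      ρ M + ρ N + nullity N ⊤ ⊓ (ρ M ∸ ρ M)
        ≡⟨ cong (λ l → ρ M + ρ N + nullity N ⊤ ⊓ l) (n∸n≡0 (ρ M)) ⟩
      ρ M + ρ N + nullity N ⊤ ⊓ 0
        ≡⟨ cong (ρ M + ρ N +_) (⊓-zeroʳ (nullity N ⊤)) ⟩
      ρ M + ρ N + 0
        ≡⟨ +-identityʳ (ρ M + ρ N) ⟩
      ρ M + ρ N ∎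
      where open ≡-Reasoning

    nullity-□ : ∀ X Y → nullity (M □ N) (X ++ Y) ≡ nullity M X + (nullity N Y ∸ rankLack M X)
    nullity-□ X Y = trans (cong₂ _∸_ ∣X++Y∣≡ (rankOf-□ X Y)) (m+n∸m≡n (x + z + b ⊓ a) _)
      where
      open ≡-Reasoning
      x z a b : ℕ
      x = rankOf M X
      z = rankOf N Y
      a = rankLack M X
      b = nullity N Y

      rearrange : ∀ x ν z q w → (x + ν) + (z + (q + w)) ≡ (x + z + q) + (ν + w)
      rearrange = solve-∀

      ∣X++Y∣≡ : ∣ X ++ Y ∣ ≡ (x + z + b ⊓ a) + (nullity M X + (b ∸ a))
      ∣X++Y∣≡ = begin
        ∣ X ++ Y ∣
          ≡⟨ ∣p++q∣≡∣p∣+∣q∣ X Y ⟩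
        ∣ X ∣ + ∣ Y ∣
          ≡⟨ cong₂ _+_ (sym (rankOf+nullity M X)) (sym (rankOf+nullity N Y)) ⟩
        (x + nullity M X) + (z + b)
          ≡⟨ cong (λ w → (x + nullity M X) + (z + w)) (sym b⊓a+[b∸a]≡b) ⟩
        (x + nullity M X) + (z + (b ⊓ a + (b ∸ a)))
          ≡⟨ rearrange x (nullity M X) z (b ⊓ a) (b ∸ a) ⟩
        (x + z + b ⊓ a) + (nullity M X + (b ∸ a)) ∎
        where
        b⊓a+[b∸a]≡b : b ⊓ a + (b ∸ a) ≡ b
        b⊓a+[b∸a]≡b = trans (cong (_+ (b ∸ a)) (⊓-comm b a)) (m⊓n+n∸m≡n a b)

    rankLack-□ : ∀ X Y → rankLack (M □ N) (X ++ Y) ≡ rankLack N Y + (rankLack M X ∸ nullity N Y)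
    rankLack-□ X Y = trans (cong₂ _∸_ ρ-□≡ (rankOf-□ X Y)) (m+n∸m≡n (x + z + b ⊓ a) _)
      where
      open ≡-Reasoning
      x z a b : ℕ
      x = rankOf M X
      z = rankOf N Y
      a = rankLack M X
      b = nullity N Y

      rearrange : ∀ x q w z c → (x + (q + w)) + (z + c) ≡ (x + z + q) + (c + w)
      rearrange = solve-∀

      ρ-□≡ : ρ (M □ N) ≡ (x + z + b ⊓ a) + (rankLack N Y + (a ∸ b))
      ρ-□≡ = begin
        ρ (M □ N)
          ≡⟨ ρ-□ ⟩
        ρ M + ρ N
          ≡⟨ cong₂ _+_ (sym (rankOf+rankLack M X)) (sym (rankOf+rankLack N Y)) ⟩
        (x + a) + (z + rankLack N Y)
          ≡⟨ cong (λ w → (x + w) + (z + rankLack N Y)) (sym (m⊓n+n∸m≡n b a)) ⟩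
        (x + (b ⊓ a + (a ∸ b))) + (z + rankLack N Y)
          ≡⟨ rearrange x (b ⊓ a) (a ∸ b) z (rankLack N Y) ⟩
        (x + z + b ⊓ a) + (rankLack N Y + (a ∸ b)) ∎

m≤n×o≤p+[n∸m]⇔m+[o∸p]≤n : ∀ m n o p → (m ≤ n × o ≤ p + (n ∸ m)) ⇔ m + (o ∸ p) ≤ n
m≤n×o≤p+[n∸m]⇔m+[o∸p]≤n m n o p = mk⇔ to from
  where
  to : m ≤ n × o ≤ p + (n ∸ m) → m + (o ∸ p) ≤ n
  to (m≤n , o≤p+[n∸m]) =
    ≤-trans (+-monoʳ-≤ m (m≤n+o⇒m∸n≤o o p o≤p+[n∸m])) (≤-reflexive (m+[n∸m]≡n m≤n))

  from : m + (o ∸ p) ≤ n → m ≤ n × o ≤ p + (n ∸ m)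
  from m+[o∸p]≤n =
    m+n≤o⇒m≤o m m+[o∸p]≤n ,
    ≤-trans (m≤n+m∸n o p)
      (+-monoʳ-≤ p (subst (_≤ n ∸ m) (m+n∸m≡n m (o ∸ p)) (∸-monoˡ-≤ m m+[o∸p]≤n)))

module _ {s t u} (M : SetSystem s) (N : SetSystem t) (P : SetSystem u)
         (M-∅ : Indep M ⊥) (N-∅ : Indep N ⊥) (P-∅ : Indep P ⊥) where

  Indep-□-assoc-++ : ∀ X Y Z →
                     Indep ((M □ N) □ P) ((X ++ Y) ++ Z) ⇔ Indep (M □ (N □ P)) (X ++ (Y ++ Z))
  Indep-□-assoc-++ X Y Z = subst₂ _⇔_ (sym left) (sym right) (mk⇔ to′ from′)
    where
    open ≡-Reasoning
    a b c d : ℕ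
    a = rankLack M X
    b = nullity N Y
    c = rankLack N Y
    d = nullity P Z

    left : Indep ((M □ N) □ P) ((X ++ Y) ++ Z) ≡ ((Indep M X × b ≤ a) × d ≤ c + (a ∸ b))
    left = begin
      Indep ((M □ N) □ P) ((X ++ Y) ++ Z)
        ≡⟨ Indep-□-++ (M □ N) P (X ++ Y) Z ⟩
      (Indep (M □ N) (X ++ Y) × d ≤ rankLack (M □ N) (X ++ Y))
        ≡⟨ cong₂ (λ I l → I × d ≤ l) (Indep-□-++ M N X Y) (rankLack-□ M-∅ N-∅ X Y) ⟩
      ((Indep M X × b ≤ a) × d ≤ c + (a ∸ b)) ∎

    right : Indep (M □ (N □ P)) (X ++ (Y ++ Z)) ≡ (Indep M X × b + (d ∸ c) ≤ a)
    right = begin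
      Indep (M □ (N □ P)) (X ++ (Y ++ Z))
        ≡⟨ Indep-□-++ M (N □ P) X (Y ++ Z) ⟩
      (Indep M X × nullity (N □ P) (Y ++ Z) ≤ a)
        ≡⟨ cong (λ ν → Indep M X × ν ≤ a) (nullity-□ N-∅ P-∅ Y Z) ⟩
      (Indep M X × b + (d ∸ c) ≤ a) ∎

    open Equivalence (m≤n×o≤p+[n∸m]⇔m+[o∸p]≤n b a d c)

    to′ : (Indep M X × b ≤ a) × d ≤ c + (a ∸ b) → Indep M X × b + (d ∸ c) ≤ a
    to′ ((indep , b≤a) , d≤c+[a∸b]) = indep , to (b≤a , d≤c+[a∸b])

    from′ : Indep M X × b + (d ∸ c) ≤ a → (Indep M X × b ≤ a) × d ≤ c + (a ∸ b)
    from′ (indep , b+[d∸c]≤a) = (indep , proj₁ (from b+[d∸c]≤a)) , proj₂ (from b+[d∸c]≤a)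

  Indep-□-assoc : ∀ A → Indep ((M □ N) □ P) A ⇔ Indep (M □ (N □ P)) (cast (+-assoc s t u) A)
  Indep-□-assoc A =
    subst (λ A′ → Indep ((M □ N) □ P) A′ ⇔ Indep (M □ (N □ P)) (cast (+-assoc s t u) A′))
          [X++Y]++Z≡A
          (subst (λ A′ → Indep ((M □ N) □ P) ((X ++ Y) ++ Z) ⇔ Indep (M □ (N □ P)) A′)
                 (sym (++-assoc-eqFree X Y Z))
                 (Indep-□-assoc-++ X Y Z))
    where
    X : Subset s
    X = take s (take (s + t) A)
    Y : Subset t
    Y = drop s (take (s + t) A)
    Z : Subset u
    Z = drop (s + t) A
    [X++Y]++Z≡A : (X ++ Y) ++ Z ≡ A
    [X++Y]++Z≡A = trans (cong (_++ Z) (take++drop≡id s (take (s + t) A))) (take++drop≡id (s + t) A)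

proposition4p4 : ∀ {s t u} (M : Matroid s) (N : Matroid t) (P : Matroid u) →
    (A : Subset ((s Data.Nat.+ t) Data.Nat.+ u)) →
    Indep ((system M □ system N) □ system P) A ⇔
      Indep (system M □ (system N □ system P)) (cast (+-assoc s t u) A)
proposition4p4 M N P =
  Indep-□-assoc (system M) (system N) (system P) (indep-⊥ M) (indep-⊥ N) (indep-⊥ P)
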